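{- Let $n,m$ be positive integers and let $\mathcal{F}=\{C_1,\ldots,C_k\}$ be a uniquely resolvable multiset with respect to $(n,m)$, with unique resolution $\{A_1,\ldots,A_n\}$, and let $d_i=|A_i|$ for $i\in[n]$. Then $$\sum_{i=1}^n \left(2^{d_i}-2\right) \le 2^m-2.$$
   Context: Write $[m]=\{1,\ldots,m\}$. Let $\mathcal{F}=\{C_1,\ldots,C_k\}$ be a multiset of non-empty subsets of $[m]$ (repetitions allowed; members indexed by $[k]$). A resolution of $\mathcal{F}$ into $n$ classes is a partition $\{A_1,\ldots,A_n\}$ of the index set $[k]$ into $n$ blocks such that for each $i$ the sets $C_j$, $j\in A_i$, are pairwise disjoint with union $[m]$. $\mathcal{F}$ is uniquely resolvable with respect to $(n,m)$ if it has exactly one such resolution, partitions being regarded as unordered (relabeling the blocks does not give a new resolution). -}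

module Defs where

open import Data.Nat using (ℕ; _∸_; _^_)
open import Data.Fin using (Fin; _≟_)
open import Data.Fin.Subset using (Subset; _∈_; _∩_; ⊥; Nonempty)
open import Data.List using (List; length; filter)
open import Data.Fin.Base using ()
open import Data.List.Base using ()
open import Data.Vec using (tabulate; sum)
open import Data.Vec using ()
open import Data.Product using (Σ; _×_; ∃)
open import Relation.Binary.PropositionalEquality using (_≡_; _≢_)
open import Function.Bundles using (_⇔_)
import Data.List as L

Family : ℕ → ℕ → Set
Family k m = Fin k → Subset m

-- A partition of the index set [k] into n blocks, encoded by a labelling
-- f : Fin k → Fin n (block A_i = f⁻¹(i)); blocks must be non-empty.
-- f is a resolution if each block is non-empty and the sets C_j, j ∈ A_i,
-- are pairwise disjoint and cover [m].
record IsResolution {k m : ℕ} (n : ℕ) (C : Family k m) (f : Fin k → Fin n) : Set where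
  field
    blocksNonempty : ∀ (i : Fin n) → ∃ λ (j : Fin k) → f j ≡ i
    disjoint : ∀ (j j′ : Fin k) → j ≢ j′ → f j ≡ f j′ → C j ∩ C j′ ≡ ⊥
    covers : ∀ (i : Fin n) (x : Fin m) → ∃ λ (j : Fin k) → f j ≡ i × x ∈ C j

SamePartition : ∀ {k n : ℕ} → (Fin k → Fin n) → (Fin k → Fin n) → Set
SamePartition {k} f g = ∀ (j j′ : Fin k) → (f j ≡ f j′) ⇔ (g j ≡ g j′)

blockSize : ∀ {k n : ℕ} → (Fin k → Fin n) → Fin n → ℕ
blockSize {k} f i = length (filter (λ j → f j ≟ i) (L.allFin k))

-- Σ_{i=1}^n (2^{d_i} − 2)  (truncated subtraction is exact since d_i ≥ 1).
resolutionSum : ∀ {k n : ℕ} → (Fin k → Fin n) → ℕ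
resolutionSum {k} {n} f = sum (tabulate {n = n} (λ i → 2 ^ blockSize f i ∸ 2))

-- Send a nonempty proper subset S of a class A_i to ⋃_{j ∈ S} C_j, a nonempty proper
-- subset of [m]. This map is injective on all classes together: inside one class because
-- the sets C_j there are nonempty and pairwise disjoint, and across classes i ≠ i′
-- because ⋃ S = ⋃ S′ would allow S and S′ to trade classes, producing a second
-- resolution.
module Submission where

open import Defs
open import Algebra.Properties.CommutativeSemigroup using (interchange)
open import Data.Bool.Base using (if_then_else_)
open import Data.Bool.Properties using () renaming (_≟_ to _≟ᵇ_)
open import Data.Empty using (⊥-elim)
open import Data.Fin using (Fin; zero; suc)
open import Data.Fin.Permutation using (Permutation′; _⟨$⟩ʳ_; _⟨$⟩ˡ_; inverseʳ; transpose; id)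
open import Data.Fin.Properties using (_≟_; any?; 0≢1+n; suc-injective)
open import Data.Fin.Subset
  using (Subset; _∈_; _∉_; _⊆_; _⊂_; _∪_; ⊥; ⊤; ∣_∣; Nonempty; inside; outside)
open import Data.Fin.Subset.Properties
  using ( _∈?_; _⊆?_; _⊂?_; nonempty?; anySubset?; Empty-unique; ∉⊥; ∈⊤; ⊥⊆; ⊆⊤; ⊆-refl
        ; ⊆-reflexive; ⊆-antisym; ⊂-irref; x∈p∩q⁺; x∈p∩q⁻; x∈p∪q⁺; x∈p∪q⁻; ∣⊤∣≡n)
open import Data.List.Base as List using (length; filter)
open import Data.Nat using (ℕ; zero; suc; _+_; _*_; _≤_; _∸_; _^_; z≤n; NonZero)
open import Data.Nat.Properties
  using ( ≤-refl; ≤-reflexive; ≤-trans; ≤-antisym; +-mono-≤; +-identityʳ; *-identityʳ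
        ; *-distribˡ-+; m+n∸n≡m; +-commutativeSemigroup; module ≤-Reasoning)
open import Data.Product.Base using (∃; _×_; _,_; proj₁; proj₂)
open import Data.Sum.Base using (inj₁; inj₂)
open import Data.Vec.Base using ([]; _∷_; here; there; tabulate; sum)
open import Data.Vec.Properties
  using (≡-dec; ∷-injectiveˡ; ∷-injectiveʳ; lookup∘tabulate; []=⇒lookup; lookup⇒[]=; tabulate-cong)
open import Function.Base using (_∘_; case_of_)
open import Function.Bundles using (Injection; Equivalence; _⇔_; mk⇔)
open import Function.Properties.Inverse using (↔⇒↣)
open import Level using (Level; 0ℓ)
open import Relation.Binary.Definitions using (DecidableEquality)
open import Relation.Binary.PropositionalEquality
  using (_≡_; _≢_; refl; sym; trans; cong; cong₂; subst; module ≡-Reasoning)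
open import Relation.Nullary using (Dec; yes; no; does; ¬_; contradiction)
open import Relation.Nullary.Decidable using (_×-dec_; _⊎-dec_; dec-true; dec-false; decidable-stable)
open import Relation.Unary using (Pred; Decidable)

private variable
  a b p q : Level
  A : Set a
  B : Set b

indicator : Dec A → ℕ
indicator a? = if does a? then 1 else 0

indicator-yes : (a? : Dec A) → A → indicator a? ≡ 1
indicator-yes (yes _) _ = refl
indicator-yes (no ¬a) a = contradiction a ¬a

indicator-no : (a? : Dec A) → ¬ A → indicator a? ≡ 0
indicator-no (yes a) ¬a = contradiction a ¬a
indicator-no (no _)  _  = refl

indicator-mono : (A → B) → (a? : Dec A) (b? : Dec B) → indicator a? ≤ indicator b?
indicator-mono A⇒B (yes a) b? = ≤-reflexive (sym (indicator-yes b? (A⇒B a)))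
indicator-mono A⇒B (no _)  b? = z≤n

indicator-cong : A ⇔ B → (a? : Dec A) (b? : Dec B) → indicator a? ≡ indicator b?
indicator-cong A⇔B a? b? =
  ≤-antisym (indicator-mono (Equivalence.to A⇔B) a? b?) (indicator-mono (Equivalence.from A⇔B) b? a?)

indicator-× : (a? : Dec A) (b? : Dec B) → indicator (a? ×-dec b?) ≡ indicator a? * indicator b?
indicator-× (yes _) (yes _) = refl
indicator-× (yes _) (no _)  = refl
indicator-× (no _)  _       = refl

indicator-⊎ : ∀ {x y} (a? : Dec A) (b? : Dec B) → x ≤ indicator a? → y ≤ indicator b? →
              ¬ (A × B) → x + y ≤ indicator (a? ⊎-dec b?)
indicator-⊎ (yes a) (yes b) _   _   ¬a×b = contradiction (a , b) ¬a×b
indicator-⊎ (yes _) (no _)  x≤1 y≤0 _    = +-mono-≤ x≤1 y≤0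
indicator-⊎ (no _)  (yes _) x≤0 y≤1 _    = +-mono-≤ x≤0 y≤1
indicator-⊎ (no _)  (no _)  x≤0 y≤0 _    = +-mono-≤ x≤0 y≤0

sumSubsets : ∀ k → (Subset k → ℕ) → ℕ
sumSubsets zero    φ = φ []
sumSubsets (suc k) φ = sumSubsets k (φ ∘ (inside ∷_)) + sumSubsets k (φ ∘ (outside ∷_))

sumSubsets-cong : ∀ k {φ ψ : Subset k → ℕ} → (∀ S → φ S ≡ ψ S) → sumSubsets k φ ≡ sumSubsets k ψ
sumSubsets-cong zero    φ≗ψ = φ≗ψ []
sumSubsets-cong (suc k) φ≗ψ =
  cong₂ _+_ (sumSubsets-cong k (φ≗ψ ∘ (inside ∷_))) (sumSubsets-cong k (φ≗ψ ∘ (outside ∷_)))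

sumSubsets-mono : ∀ k {φ ψ : Subset k → ℕ} → (∀ S → φ S ≤ ψ S) → sumSubsets k φ ≤ sumSubsets k ψ
sumSubsets-mono zero    φ≤ψ = φ≤ψ []
sumSubsets-mono (suc k) φ≤ψ =
  +-mono-≤ (sumSubsets-mono k (φ≤ψ ∘ (inside ∷_))) (sumSubsets-mono k (φ≤ψ ∘ (outside ∷_)))

sumSubsets-zero : ∀ k → sumSubsets k (λ _ → 0) ≡ 0
sumSubsets-zero zero    = refl
sumSubsets-zero (suc k) = cong₂ _+_ (sumSubsets-zero k) (sumSubsets-zero k)

sumSubsets-+ : ∀ k (φ ψ : Subset k → ℕ) →
               sumSubsets k (λ S → φ S + ψ S) ≡ sumSubsets k φ + sumSubsets k ψ
sumSubsets-+ zero    φ ψ = refl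
sumSubsets-+ (suc k) φ ψ =
  trans (cong₂ _+_ (sumSubsets-+ k φ₁ ψ₁) (sumSubsets-+ k φ₀ ψ₀))
        (interchange +-commutativeSemigroup
                     (sumSubsets k φ₁) (sumSubsets k ψ₁) (sumSubsets k φ₀) (sumSubsets k ψ₀))
  where
  φ₁ = φ ∘ (inside ∷_)
  ψ₁ = ψ ∘ (inside ∷_)
  φ₀ = φ ∘ (outside ∷_)
  ψ₀ = ψ ∘ (outside ∷_)

sumSubsets-*ˡ : ∀ k c (φ : Subset k → ℕ) → sumSubsets k (λ S → c * φ S) ≡ c * sumSubsets k φ
sumSubsets-*ˡ zero    c φ = refl
sumSubsets-*ˡ (suc k) c φ =
  trans (cong₂ _+_ (sumSubsets-*ˡ k c _) (sumSubsets-*ˡ k c _)) (sym (*-distribˡ-+ c _ _))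

sumSubsets-comm : ∀ k m (h : Subset k → Subset m → ℕ) →
                  sumSubsets k (λ S → sumSubsets m (h S)) ≡ sumSubsets m (λ U → sumSubsets k (λ S → h S U))
sumSubsets-comm zero    m h = refl
sumSubsets-comm (suc k) m h =
  trans (cong₂ _+_ (sumSubsets-comm k m _) (sumSubsets-comm k m _)) (sym (sumSubsets-+ m _ _))

sum-tabulate-sumSubsets : ∀ n k (h : Fin n → Subset k → ℕ) →
                          sum (tabulate (λ i → sumSubsets k (h i)))
                            ≡ sumSubsets k (λ S → sum (tabulate (λ i → h i S)))
sum-tabulate-sumSubsets zero    k h = sym (sumSubsets-zero k)
sum-tabulate-sumSubsets (suc n) k h =
  trans (cong (sumSubsets k (h zero) +_) (sum-tabulate-sumSubsets n k (h ∘ suc)))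
        (sym (sumSubsets-+ k _ _))

count : ∀ {k} {P : Pred (Subset k) p} → Decidable P → ℕ
count {k = k} P? = sumSubsets k (indicator ∘ P?)

_≟ₛ_ : ∀ {n} → DecidableEquality (Subset n)
_≟ₛ_ = ≡-dec _≟ᵇ_

count-singleton : ∀ {k} (V : Subset k) → count (_≟ₛ V) ≡ 1
count-singleton []             = refl
count-singleton {suc k} (inside ∷ V)  = cong₂ _+_ (count-singleton V) (sumSubsets-zero k)
count-singleton {suc k} (outside ∷ V) = cong₂ _+_ (sumSubsets-zero k) (count-singleton V)

count-⊆ : ∀ {k} (T : Subset k) → count (_⊆? T) ≡ 2 ^ ∣ T ∣
count-⊆ []                   = refl
count-⊆ {suc k} (inside ∷ T)  =
  trans (cong₂ _+_ (count-⊆ T) (count-⊆ T)) (cong (2 ^ ∣ T ∣ +_) (sym (+-identityʳ _)))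
count-⊆ {suc k} (outside ∷ T) = cong₂ _+_ (sumSubsets-zero k) (count-⊆ T)

sum-indicator≤any : ∀ {n p} {P : Pred (Fin n) p} (P? : Decidable P) →
                    (∀ {i i′} → P i → P i′ → i ≡ i′) →
                    sum (tabulate (indicator ∘ P?)) ≤ indicator (any? P?)
sum-indicator≤any {zero}  P? unique = z≤n
sum-indicator≤any {suc n} P? unique =
  indicator-⊎ (P? zero) (any? (P? ∘ suc)) ≤-refl
    (sum-indicator≤any (P? ∘ suc) (λ p p′ → suc-injective (unique p p′)))
    (λ (p , _ , p′) → 0≢1+n (unique p p′))

count≤anySubset : ∀ {k} {P : Pred (Subset k) p} (P? : Decidable P) →
                  (∀ {S S′} → P S → P S′ → S ≡ S′) → count P? ≤ indicator (anySubset? P?)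
count≤anySubset {k = zero}  P? unique = ≤-refl
count≤anySubset {k = suc k} P? unique =
  indicator-⊎ (anySubset? (P? ∘ (inside ∷_))) (anySubset? (P? ∘ (outside ∷_)))
    (count≤anySubset (P? ∘ (inside ∷_)) (λ p p′ → ∷-injectiveʳ (unique p p′)))
    (count≤anySubset (P? ∘ (outside ∷_)) (λ p p′ → ∷-injectiveʳ (unique p p′)))
    (λ ((_ , p) , (_ , p′)) → case ∷-injectiveˡ (unique p p′) of λ ())

count-≤-injective : ∀ {k m} {P : Pred (Subset k) p} {Q : Pred (Subset m) q}
                    (P? : Decidable P) (Q? : Decidable Q) (u : Subset k → Subset m) →
                    (∀ {S} → P S → Q (u S)) → (∀ {S S′} → P S → P S′ → u S ≡ u S′ → S ≡ S′) →
                    count P? ≤ count Q?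
count-≤-injective {k = k} {m} {P = P} {Q = Q} P? Q? u P⇒Q u-injective = begin
  sumSubsets k (λ S → indicator (P? S))
    ≡⟨ sumSubsets-cong k (λ S →
         sym (trans (cong (indicator (P? S) *_) (count-singleton (u S))) (*-identityʳ _))) ⟩
  sumSubsets k (λ S → indicator (P? S) * sumSubsets m (λ U → indicator (U ≟ₛ u S)))
    ≡⟨ sumSubsets-cong k (λ S → sym (sumSubsets-*ˡ m (indicator (P? S)) _)) ⟩
  sumSubsets k (λ S → sumSubsets m (λ U → indicator (P? S) * indicator (U ≟ₛ u S)))
    ≡⟨ sumSubsets-comm k m _ ⟩
  sumSubsets m (λ U → sumSubsets k (λ S → indicator (P? S) * indicator (U ≟ₛ u S)))
    ≡⟨ sumSubsets-cong m (λ U → sumSubsets-cong k (λ S → sym (indicator-× (P? S) (U ≟ₛ u S)))) ⟩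
  sumSubsets m (λ U → count (fiber? U))
    ≤⟨ sumSubsets-mono m fiber≤Q ⟩
  sumSubsets m (λ U → indicator (Q? U)) ∎
  where
  open ≤-Reasoning
  fiber? : ∀ U → Decidable (λ S → P S × U ≡ u S)
  fiber? U S = P? S ×-dec (U ≟ₛ u S)
  fiber≤Q : ∀ U → count (fiber? U) ≤ indicator (Q? U)
  fiber≤Q U = ≤-trans
    (count≤anySubset (fiber? U) (λ (p , U≡uS) (p′ , U≡uS′) → u-injective p p′ (trans (sym U≡uS) U≡uS′)))
    (indicator-mono (λ (S , p , U≡uS) → subst Q (sym U≡uS) (P⇒Q p)) (anySubset? (fiber? U)) (Q? U))

≢⊥⇒Nonempty : ∀ {n} {S : Subset n} → S ≢ ⊥ → Nonempty S
≢⊥⇒Nonempty {S = S} S≢⊥ = decidable-stable (nonempty? S) (S≢⊥ ∘ Empty-unique)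

⊆∧≢⇒⊂ : ∀ {n} {S T : Subset n} → S ⊆ T → S ≢ T → S ⊂ T
⊆∧≢⇒⊂ {S = S} {T} S⊆T S≢T = decidable-stable (S ⊂? T) λ S⊄T →
  S≢T (⊆-antisym S⊆T (λ {x} x∈T → decidable-stable (x ∈? S) (λ x∉S → S⊄T (S⊆T , x , x∈T , x∉S))))

NonemptyProper : ∀ {n} → Subset n → Pred (Subset n) 0ℓ
NonemptyProper T S = Nonempty S × S ⊂ T

nonemptyProper? : ∀ {n} (T : Subset n) → Decidable (NonemptyProper T)
nonemptyProper? T S = nonempty? S ×-dec S ⊂? T

indicator-⊆-split : ∀ {n} {T : Subset n} → Nonempty T → ∀ S →
  indicator (S ⊆? T) ≡ indicator (nonemptyProper? T S) + (indicator (S ≟ₛ ⊥) + indicator (S ≟ₛ T))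
indicator-⊆-split {T = T} (x , x∈T) S with S ≟ₛ ⊥ | S ≟ₛ T
... | yes refl | yes refl = contradiction x∈T ∉⊥
... | yes refl | no _     = trans (indicator-yes (⊥ ⊆? T) ⊥⊆)
  (sym (cong (_+ 1) (indicator-no (nonemptyProper? T ⊥) (λ ((_ , y∈⊥) , _) → ∉⊥ y∈⊥))))
... | no _     | yes refl = trans (indicator-yes (T ⊆? T) ⊆-refl)
  (sym (cong (_+ 1) (indicator-no (nonemptyProper? T T) (⊂-irref refl ∘ proj₂))))
... | no S≢⊥   | no S≢T   = trans
  (indicator-cong (mk⇔ (λ (S⊆T : S ⊆ T) → ≢⊥⇒Nonempty S≢⊥ , ⊆∧≢⇒⊂ S⊆T S≢T) (proj₁ ∘ proj₂))
                  (S ⊆? T) (nonemptyProper? T S))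
  (sym (+-identityʳ _))

count-nonemptyProper : ∀ {n} {T : Subset n} → Nonempty T → count (nonemptyProper? T) ≡ 2 ^ ∣ T ∣ ∸ 2
count-nonemptyProper {n} {T} T-nonempty = begin
  count (nonemptyProper? T)         ≡⟨ sym (m+n∸n≡m _ 2) ⟩
  count (nonemptyProper? T) + 2 ∸ 2 ≡⟨ cong (_∸ 2) (sym count⊆T) ⟩
  2 ^ ∣ T ∣ ∸ 2                     ∎
  where
  open ≡-Reasoning
  count⊆T : 2 ^ ∣ T ∣ ≡ count (nonemptyProper? T) + 2
  count⊆T = begin
    2 ^ ∣ T ∣
      ≡⟨ sym (count-⊆ T) ⟩
    count (_⊆? T)
      ≡⟨ sumSubsets-cong n (indicator-⊆-split T-nonempty) ⟩
    sumSubsets n (λ S → indicator (nonemptyProper? T S) + (indicator (S ≟ₛ ⊥) + indicator (S ≟ₛ T)))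
      ≡⟨ sumSubsets-+ n _ _ ⟩
    count (nonemptyProper? T) + sumSubsets n (λ S → indicator (S ≟ₛ ⊥) + indicator (S ≟ₛ T))
      ≡⟨ cong (count (nonemptyProper? T) +_)
              (trans (sumSubsets-+ n _ _) (cong₂ _+_ (count-singleton (⊥ {n})) (count-singleton T))) ⟩
    count (nonemptyProper? T) + 2 ∎

⋃[_]_ : ∀ {k m} → Subset k → (Fin k → Subset m) → Subset m
⋃[ [] ]          C = ⊥
⋃[ inside ∷ S ]  C = C zero ∪ ⋃[ S ] (C ∘ suc)
⋃[ outside ∷ S ] C = ⋃[ S ] (C ∘ suc)

∈⋃⁺ : ∀ {k m} {C : Fin k → Subset m} {S j x} → j ∈ S → x ∈ C j → x ∈ ⋃[ S ] C
∈⋃⁺ {S = inside ∷ S} here        x∈Cj = x∈p∪q⁺ (inj₁ x∈Cj)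
∈⋃⁺ {S = inside ∷ S} (there j∈S) x∈Cj = x∈p∪q⁺ (inj₂ (∈⋃⁺ j∈S x∈Cj))
∈⋃⁺ {S = outside ∷ S} (there j∈S) x∈Cj = ∈⋃⁺ j∈S x∈Cj

∈⋃⁻ : ∀ {k m} {C : Fin k → Subset m} (S : Subset k) {x} → x ∈ ⋃[ S ] C → ∃ λ j → j ∈ S × x ∈ C j
∈⋃⁻ []               x∈⋃ = contradiction x∈⋃ ∉⊥
∈⋃⁻ {C = C} (inside ∷ S) x∈⋃ with x∈p∪q⁻ (C zero) (⋃[ S ] (C ∘ suc)) x∈⋃
... | inj₁ x∈C₀ = zero , here , x∈C₀
... | inj₂ x∈⋃S = let j , j∈S , x∈Cj = ∈⋃⁻ S x∈⋃S in suc j , there j∈S , x∈Cj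
∈⋃⁻ (outside ∷ S) x∈⋃ = let j , j∈S , x∈Cj = ∈⋃⁻ S x∈⋃ in suc j , there j∈S , x∈Cj

block : ∀ {k n} → (Fin k → Fin n) → Fin n → Subset k
block f i = tabulate (λ j → does (f j ≟ i))

module _ {k n} (f : Fin k → Fin n) {i : Fin n} {j : Fin k} where

  ∈-block⁺ : f j ≡ i → j ∈ block f i
  ∈-block⁺ fj≡i = lookup⇒[]= j (block f i) (trans (lookup∘tabulate _ j) (dec-true (f j ≟ i) fj≡i))

  ∈-block⁻ : j ∈ block f i → f j ≡ i
  ∈-block⁻ j∈ = decidable-stable (f j ≟ i) λ fj≢i →
    case trans (sym ([]=⇒lookup j∈)) (trans (lookup∘tabulate _ j) (dec-false (f j ≟ i) fj≢i)) of λ ()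

nonemptyProper-block-unique : ∀ {k n} (f : Fin k → Fin n) {i i′ S} →
  NonemptyProper (block f i) S → NonemptyProper (block f i′) S → i ≡ i′
nonemptyProper-block-unique f ((j , j∈S) , S⊆Aᵢ , _) (_ , S⊆Aᵢ′ , _) =
  trans (sym (∈-block⁻ f (S⊆Aᵢ j∈S))) (∈-block⁻ f (S⊆Aᵢ′ j∈S))

∣tabulate-does∣≡length-filter : ∀ {P : Pred A p} (P? : Decidable P) k (h : Fin k → A) →
  ∣ tabulate (λ j → does (P? (h j))) ∣ ≡ length (filter P? (List.tabulate h))
∣tabulate-does∣≡length-filter P? zero    h = refl
∣tabulate-does∣≡length-filter P? (suc k) h with P? (h zero)
... | yes _ = cong suc (∣tabulate-does∣≡length-filter P? k (h ∘ suc))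
... | no _  = ∣tabulate-does∣≡length-filter P? k (h ∘ suc)

∣block∣≡blockSize : ∀ {k n} (f : Fin k → Fin n) i → ∣ block f i ∣ ≡ blockSize f i
∣block∣≡blockSize {k} f i = ∣tabulate-does∣≡length-filter (λ j → f j ≟ i) k (λ j → j)

module _ {n} (i i′ : Fin n) where

  transpose-matchˡ : transpose i i′ ⟨$⟩ʳ i ≡ i′
  transpose-matchˡ rewrite dec-true (i ≟ i) refl = refl

  transpose-fixes : ∀ {l} → l ≢ i → l ≢ i′ → transpose i i′ ⟨$⟩ʳ l ≡ l
  transpose-fixes {l} l≢i l≢i′ rewrite dec-false (l ≟ i) l≢i | dec-false (l ≟ i′) l≢i′ = refl

module _ {k m n} {C : Family k m} {f : Fin k → Fin n} (f-resolution : IsResolution n C f) where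
  open IsResolution f-resolution

  meet⇒≡ : ∀ {j j′ x} → f j ≡ f j′ → x ∈ C j → x ∈ C j′ → j ≡ j′
  meet⇒≡ {j} {j′} {x} fj≡fj′ x∈Cj x∈Cj′ = decidable-stable (j ≟ j′) λ j≢j′ →
    ∉⊥ (subst (x ∈_) (disjoint j j′ j≢j′ fj≡fj′) (x∈p∩q⁺ (x∈Cj , x∈Cj′)))

  pointwisePermuted-isResolution : (g : Fin k → Fin n) (π : Fin m → Permutation′ n) →
    (∀ {x j} → x ∈ C j → g j ≡ π x ⟨$⟩ʳ f j) → Fin m → IsResolution n C g
  pointwisePermuted-isResolution g π g≡πf x₀ = record
    { blocksNonempty = λ l → let j , gj≡l , _ = covers′ l x₀ in j , gj≡l
    ; disjoint = λ j j′ j≢j′ gj≡gj′ → Empty-unique λ (x , x∈) →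
        let x∈Cj , x∈Cj′ = x∈p∩q⁻ (C j) (C j′) x∈
            fj≡fj′ = Injection.injective (↔⇒↣ (π x)) (trans (sym (g≡πf x∈Cj)) (trans gj≡gj′ (g≡πf x∈Cj′)))
        in ∉⊥ (subst (x ∈_) (disjoint j j′ j≢j′ fj≡fj′) x∈)
    ; covers = covers′
    }
    where
    covers′ : ∀ l x → ∃ λ j → g j ≡ l × x ∈ C j
    covers′ l x = let j , fj≡ , x∈Cj = covers (π x ⟨$⟩ˡ l) x
                  in j , trans (g≡πf x∈Cj) (trans (cong (π x ⟨$⟩ʳ_) fj≡) (inverseʳ (π x))) , x∈Cj

  ∈⋃⇒∈ : ∀ {i S j x} → S ⊆ block f i → f j ≡ i → x ∈ C j → x ∈ ⋃[ S ] C → j ∈ S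
  ∈⋃⇒∈ {S = S} S⊆Aᵢ fj≡i x∈Cj x∈⋃S = let c , c∈S , x∈Cc = ∈⋃⁻ S x∈⋃S in
    subst (_∈ S) (meet⇒≡ (trans (∈-block⁻ f (S⊆Aᵢ c∈S)) (sym fj≡i)) x∈Cc x∈Cj) c∈S

  module Swap {i i′ : Fin n} (i≢i′ : i ≢ i′) {S S′ : Subset k} (S⊆Aᵢ : S ⊆ block f i)
              (S′⊆Aᵢ′ : S′ ⊆ block f i′) (⋃S≡⋃S′ : ⋃[ S ] C ≡ ⋃[ S′ ] C) where

    swapped : Fin k → Fin n
    swapped j with j ∈? S ∪ S′
    ... | yes _ = transpose i i′ ⟨$⟩ʳ f j
    ... | no _  = f j

    swapped-∈ : ∀ {j} → j ∈ S ∪ S′ → swapped j ≡ transpose i i′ ⟨$⟩ʳ f j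
    swapped-∈ {j} j∈ with j ∈? S ∪ S′
    ... | yes _ = refl
    ... | no j∉ = contradiction j∈ j∉

    swapped-∉ : ∀ {j} → j ∉ S ∪ S′ → swapped j ≡ f j
    swapped-∉ {j} j∉ with j ∈? S ∪ S′
    ... | yes j∈ = contradiction j∈ j∉
    ... | no _   = refl

    π : Fin m → Permutation′ n
    π x with x ∈? ⋃[ S ] C
    ... | yes _ = transpose i i′
    ... | no _  = id

    ∈S∪S′⇒∈⋃ : ∀ {j x} → j ∈ S ∪ S′ → x ∈ C j → x ∈ ⋃[ S ] C
    ∈S∪S′⇒∈⋃ {j} {x} j∈ x∈Cj with x∈p∪q⁻ S S′ j∈
    ... | inj₁ j∈S  = ∈⋃⁺ j∈S x∈Cj
    ... | inj₂ j∈S′ = subst (x ∈_) (sym ⋃S≡⋃S′) (∈⋃⁺ j∈S′ x∈Cj)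

    -- Over a point of ⋃ S = ⋃ S′ the classes i and i′ trade their members from S and S′;
    -- over any other point no member containing it changes class.
    swapped≡πf : ∀ {x j} → x ∈ C j → swapped j ≡ π x ⟨$⟩ʳ f j
    swapped≡πf {x} {j} x∈Cj with x ∈? ⋃[ S ] C | j ∈? S ∪ S′
    ... | yes _   | yes _  = refl
    ... | yes x∈⋃ | no j∉  = sym (transpose-fixes i i′ fj≢i fj≢i′)
      where
      fj≢i : f j ≢ i
      fj≢i fj≡i = j∉ (x∈p∪q⁺ (inj₁ (∈⋃⇒∈ S⊆Aᵢ fj≡i x∈Cj x∈⋃)))
      fj≢i′ : f j ≢ i′
      fj≢i′ fj≡i′ = j∉ (x∈p∪q⁺ (inj₂ (∈⋃⇒∈ S′⊆Aᵢ′ fj≡i′ x∈Cj (subst (x ∈_) ⋃S≡⋃S′ x∈⋃))))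
    ... | no x∉⋃  | yes j∈ = contradiction (∈S∪S′⇒∈⋃ j∈ x∈Cj) x∉⋃
    ... | no _    | no _   = refl

    swapped-isResolution : Fin m → IsResolution n C swapped
    swapped-isResolution = pointwisePermuted-isResolution swapped π swapped≡πf

    swapped-separates : NonemptyProper (block f i) S → ¬ SamePartition f swapped
    swapped-separates ((b , b∈S) , _ , a , a∈Aᵢ , a∉S) same = i≢i′ (begin
      i                          ≡⟨ sym (∈-block⁻ f a∈Aᵢ) ⟩
      f a                        ≡⟨ sym (swapped-∉ a∉S∪S′) ⟩
      swapped a                  ≡⟨ Equivalence.to (same a b) (trans (∈-block⁻ f a∈Aᵢ) (sym fb≡i)) ⟩
      swapped b                  ≡⟨ swapped-∈ (x∈p∪q⁺ (inj₁ b∈S)) ⟩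
      transpose i i′ ⟨$⟩ʳ f b    ≡⟨ cong (transpose i i′ ⟨$⟩ʳ_) fb≡i ⟩
      transpose i i′ ⟨$⟩ʳ i      ≡⟨ transpose-matchˡ i i′ ⟩
      i′                         ∎)
      where
      open ≡-Reasoning
      fb≡i : f b ≡ i
      fb≡i = ∈-block⁻ f (S⊆Aᵢ b∈S)
      a∉S∪S′ : a ∉ S ∪ S′
      a∉S∪S′ a∈ with x∈p∪q⁻ S S′ a∈
      ... | inj₁ a∈S  = a∉S a∈S
      ... | inj₂ a∈S′ = i≢i′ (trans (sym (∈-block⁻ f a∈Aᵢ)) (∈-block⁻ f (S′⊆Aᵢ′ a∈S′)))

module _ {k m n} {C : Family k m} (C-nonempty : ∀ j → Nonempty (C j))
         {f : Fin k → Fin n} (f-resolution : IsResolution n C f) where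
  open IsResolution f-resolution

  ⋃-reflects-⊆ : ∀ {i S S′} → S ⊆ block f i → S′ ⊆ block f i → ⋃[ S ] C ⊆ ⋃[ S′ ] C → S ⊆ S′
  ⋃-reflects-⊆ S⊆Aᵢ S′⊆Aᵢ ⋃S⊆⋃S′ j∈S = let x , x∈Cj = C-nonempty _ in
    ∈⋃⇒∈ f-resolution S′⊆Aᵢ (∈-block⁻ f (S⊆Aᵢ j∈S)) x∈Cj (⋃S⊆⋃S′ (∈⋃⁺ j∈S x∈Cj))

  ⋃-nonemptyProper : ∀ {i S} → NonemptyProper (block f i) S → NonemptyProper ⊤ (⋃[ S ] C)
  ⋃-nonemptyProper ((j , j∈S) , S⊆Aᵢ , a , a∈Aᵢ , a∉S) =
    (let x , x∈Cj = C-nonempty j in x , ∈⋃⁺ j∈S x∈Cj) ,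
    ⊆⊤ ,
    (let x , x∈Ca = C-nonempty a in x , ∈⊤ , a∉S ∘ ∈⋃⇒∈ f-resolution S⊆Aᵢ (∈-block⁻ f a∈Aᵢ) x∈Ca)

  count-nonemptyProper-block : ∀ i → count (nonemptyProper? (block f i)) ≡ 2 ^ blockSize f i ∸ 2
  count-nonemptyProper-block i = let j , fj≡i = blocksNonempty i in
    trans (count-nonemptyProper (j , ∈-block⁺ f fj≡i)) (cong (λ d → 2 ^ d ∸ 2) (∣block∣≡blockSize f i))

  ⋃-injective : (∀ g → IsResolution n C g → SamePartition f g) →
                ∀ {i i′ S S′} → NonemptyProper (block f i) S → NonemptyProper (block f i′) S′ →
                ⋃[ S ] C ≡ ⋃[ S′ ] C → S ≡ S′
  ⋃-injective f-unique {i} {i′} S-proper@((j , j∈S) , S⊆Aᵢ , _) (_ , S′⊆Aᵢ′ , _) ⋃S≡⋃S′ with i ≟ i′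
  ... | yes refl = ⊆-antisym (⋃-reflects-⊆ S⊆Aᵢ S′⊆Aᵢ′ (⊆-reflexive ⋃S≡⋃S′))
                             (⋃-reflects-⊆ S′⊆Aᵢ′ S⊆Aᵢ (⊆-reflexive (sym ⋃S≡⋃S′)))
  ... | no i≢i′  =
    ⊥-elim (swapped-separates S-proper (f-unique swapped (swapped-isResolution (proj₁ (C-nonempty j)))))
    where open Swap f-resolution i≢i′ S⊆Aᵢ S′⊆Aᵢ′ ⋃S≡⋃S′

⊤-nonempty : ∀ m .{{_ : NonZero m}} → Nonempty (⊤ {m})
⊤-nonempty (suc m) = zero , ∈⊤

lemma13 : (n m k : ℕ) → .{{NonZero n}} → .{{NonZero m}} →
          (C : Family k m) → (∀ (j : Fin k) → Nonempty (C j)) →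
          (f : Fin k → Fin n) → IsResolution n C f →
          (∀ (g : Fin k → Fin n) → IsResolution n C g → SamePartition f g) →
          resolutionSum f ≤ 2 ^ m ∸ 2
lemma13 n m k C C-nonempty f f-resolution f-unique = begin
  resolutionSum f
    ≡⟨ cong sum (tabulate-cong (λ i → sym (count-nonemptyProper-block C-nonempty f-resolution i))) ⟩
  sum (tabulate (λ i → count (nonemptyProper? (block f i))))
    ≡⟨ sum-tabulate-sumSubsets n k _ ⟩
  sumSubsets k (λ S → sum (tabulate (λ i → indicator (nonemptyProper? (block f i) S))))
    ≤⟨ sumSubsets-mono k (λ S → sum-indicator≤any (λ i → nonemptyProper? (block f i) S)
                                  (nonemptyProper-block-unique f)) ⟩
  count properInSomeBlock?
    ≤⟨ count-≤-injective properInSomeBlock? (nonemptyProper? (⊤ {m})) (λ S → ⋃[ S ] C)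
         (λ (_ , S-proper) → ⋃-nonemptyProper C-nonempty f-resolution S-proper)
         (λ (_ , S-proper) (_ , S′-proper) → ⋃-injective C-nonempty f-resolution f-unique S-proper S′-proper) ⟩
  count (nonemptyProper? (⊤ {m}))
    ≡⟨ count-nonemptyProper (⊤-nonempty m) ⟩
  2 ^ ∣ ⊤ {m} ∣ ∸ 2
    ≡⟨ cong (λ d → 2 ^ d ∸ 2) (∣⊤∣≡n m) ⟩
  2 ^ m ∸ 2 ∎
  where
  open ≤-Reasoning
  properInSomeBlock? : Decidable (λ S → ∃ λ i → NonemptyProper (block f i) S)
  properInSomeBlock? S = any? (λ i → nonemptyProper? (block f i) S)
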